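{- If $(t_k)$ and $(\tau_k)$, $k=0,1,2,\ldots$, are a binomial-transform pair of the first kind, then so are the sequences \[ a_k=\frac{1}{k+1}\sum_{j=0}^k\tau_j\quad\text{and}\quad \alpha_k=\frac{t_k}{k+1},\qquad k=0,1,2,\ldots. \]
   Context: Two sequences $(t_k)_{k\ge0}$ and $(\tau_k)_{k\ge0}$ of complex numbers form a binomial-transform pair of the first kind if $\tau_n=\sum_{k=0}^n(-1)^k\binom nk t_k$ for every non-negative integer $n$ (equivalently $t_n=\sum_{k=0}^n(-1)^k\binom nk\tau_k$ for every $n\ge0$). -}

module Defs where

open import Level using (Level)
open import Data.Nat using (ℕ; zero; suc)
open import Data.Nat.Combinatorics using (_C_)
open import Algebra.Bundles using (CommutativeRing)

-- Everything is relative to a commutative ring R (the paper uses R = ℂ).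
module _ {c ℓ : Level} (R : CommutativeRing c ℓ) where
  open CommutativeRing R

  ι : ℕ → Carrier
  ι zero    = 0#
  ι (suc n) = 1# + ι n

  alt : ℕ → Carrier → Carrier
  alt zero    x = x
  alt (suc k) x = - alt k x

  Σ≤ : ℕ → (ℕ → Carrier) → Carrier
  Σ≤ zero    f = f 0
  Σ≤ (suc n) f = Σ≤ n f + f (suc n)

  BinomialPair₁ : (ℕ → Carrier) → (ℕ → Carrier) → Set ℓ
  BinomialPair₁ t τ = ∀ n → τ n ≈ Σ≤ n (λ k → alt k (ι (n C k) * t k))

module Submission where

open import Defs
open import Level using (Level)
open import Data.Nat using (ℕ; suc)
open import Algebra.Bundles using (CommutativeRing)

open import Data.Nat as Nat using (zero)
open import Data.Nat.Properties using (n<1+n)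
open import Data.Nat.Combinatorics using (_C_; nC1≡n; nCk+nC[k+1]≡[n+1]C[k+1]; k>n⇒nCk≡0)
open import Data.Nat.Tactic.RingSolver using (solve-∀)
open import Function using (_∘_; _$_)
open import Relation.Binary.PropositionalEquality as ≡ using (_≡_)

-- Absorption (n+1)·C(n,k) = (k+1)·C(n+1,k+1) turns (n+1)·Σ_k (-1)^k C(n,k) a_k into
-- Σ_k (-1)^k C(n+1,k+1) S_k, where S_k = τ_0 + ⋯ + τ_k.  Pascal's rule, in the form
-- B f (n+1) = B f n − B (f ∘ suc) n for the binomial transform B, applied to the shifted
-- partial sums 0, S_0, S_1, … (whose differences are the τ_k) turns this into (B τ)_n,
-- which is t_n because B is an involution.

module _ where

  open Nat using (_+_; _*_)
  open import Data.Nat.Properties using (*-identityʳ)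

  [1+n]*nCk≡[1+n]C[1+k]*[1+k] : ∀ n k → suc n * (n C k) ≡ (suc n C suc k) * suc k
  [1+n]*nCk≡[1+n]C[1+k]*[1+k] zero    zero    = ≡.refl
  [1+n]*nCk≡[1+n]C[1+k]*[1+k] zero    (suc k) = ≡.refl
  [1+n]*nCk≡[1+n]C[1+k]*[1+k] (suc n) zero    =
    ≡.trans (*-identityʳ (2 + n)) (≡.sym (≡.trans (*-identityʳ _) (nC1≡n (2 + n))))
  [1+n]*nCk≡[1+n]C[1+k]*[1+k] (suc n) (suc k) = begin
    (2 + n) * c                       ≡⟨ ≡.cong ((2 + n) *_) (pascal n k) ⟨
    (2 + n) * (a + b)                 ≡⟨ expand n a b ⟩
    (suc n * a + suc n * b) + (a + b) ≡⟨ ≡.cong₂ _+_ (≡.cong₂ _+_ IH IH′) (pascal n k) ⟩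
    (c * suc k + d * (2 + k)) + c     ≡⟨ collect k c d ⟩
    (c + d) * (2 + k)                 ≡⟨ ≡.cong (_* (2 + k)) (pascal (suc n) (suc k)) ⟩
    ((2 + n) C (2 + k)) * (2 + k)     ∎
    where
    open ≡.≡-Reasoning
    pascal : ∀ n k → n C k + n C suc k ≡ suc n C suc k
    pascal = nCk+nC[k+1]≡[n+1]C[k+1]
    a b c d : ℕ
    a = n C k
    b = n C suc k
    c = suc n C suc k
    d = suc n C (2 + k)
    IH : suc n * a ≡ c * suc k
    IH = [1+n]*nCk≡[1+n]C[1+k]*[1+k] n k
    IH′ : suc n * b ≡ d * (2 + k)
    IH′ = [1+n]*nCk≡[1+n]C[1+k]*[1+k] n (suc k)
    expand : ∀ n a b → (2 + n) * (a + b) ≡ (suc n * a + suc n * b) + (a + b)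
    expand = solve-∀
    collect : ∀ k c d → (c * suc k + d * (2 + k)) + c ≡ (c + d) * (2 + k)
    collect = solve-∀

module BinomialTransform {c ℓ : Level} (R : CommutativeRing c ℓ) where

  open CommutativeRing R
  open import Algebra.Properties.Ring ring
    using (-0#≈0#; -‿involutive; -‿+-comm; ⁻¹-anti-homo‿-; xyx⁻¹≈y; //-rightDividesˡ;
           -‿distribʳ-*; x[y-z]≈xy-xz)
  open import Algebra.Properties.CommutativeSemigroup +-commutativeSemigroup using (interchange)
  open import Relation.Binary.Reasoning.Setoid setoid

  *-inverse-cancelˡ : ∀ {y z} → y * z ≈ 1# → ∀ x → y * (z * x) ≈ x
  *-inverse-cancelˡ {y} {z} yz≈1 x = begin
    y * (z * x) ≈⟨ *-assoc y z x ⟨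
    (y * z) * x ≈⟨ *-congʳ yz≈1 ⟩
    1# * x      ≈⟨ *-identityˡ x ⟩
    x           ∎

  Σ≤-cong : ∀ n {f g} → (∀ k → f k ≈ g k) → Σ≤ R n f ≈ Σ≤ R n g
  Σ≤-cong zero    f≈g = f≈g 0
  Σ≤-cong (suc n) f≈g = +-cong (Σ≤-cong n f≈g) (f≈g (suc n))

  Σ≤-distrib-+ : ∀ n f g → Σ≤ R n (λ k → f k + g k) ≈ Σ≤ R n f + Σ≤ R n g
  Σ≤-distrib-+ zero    f g = refl
  Σ≤-distrib-+ (suc n) f g = trans (+-congʳ (Σ≤-distrib-+ n f g)) (interchange _ _ _ _)

  Σ≤-neg : ∀ n f → Σ≤ R n (λ k → - f k) ≈ - Σ≤ R n f
  Σ≤-neg zero    f = refl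
  Σ≤-neg (suc n) f = trans (+-congʳ (Σ≤-neg n f)) (-‿+-comm _ _)

  Σ≤-distrib-- : ∀ n f g → Σ≤ R n (λ k → f k - g k) ≈ Σ≤ R n f - Σ≤ R n g
  Σ≤-distrib-- n f g = trans (Σ≤-distrib-+ n f (-_ ∘ g)) (+-congˡ (Σ≤-neg n g))

  *-distribˡ-Σ≤ : ∀ n x f → x * Σ≤ R n f ≈ Σ≤ R n (λ k → x * f k)
  *-distribˡ-Σ≤ zero    x f = refl
  *-distribˡ-Σ≤ (suc n) x f = trans (distribˡ x _ _) (+-congʳ (*-distribˡ-Σ≤ n x f))

  Σ≤-sucˡ : ∀ n f → Σ≤ R (suc n) f ≈ f 0 + Σ≤ R n (f ∘ suc)
  Σ≤-sucˡ zero    f = refl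
  Σ≤-sucˡ (suc n) f = trans (+-congʳ (Σ≤-sucˡ n f)) (+-assoc _ _ _)

  alt-cong : ∀ k {x y} → x ≈ y → alt R k x ≈ alt R k y
  alt-cong zero    x≈y = x≈y
  alt-cong (suc k) x≈y = -‿cong (alt-cong k x≈y)

  alt-distrib-+ : ∀ k x y → alt R k (x + y) ≈ alt R k x + alt R k y
  alt-distrib-+ zero    x y = refl
  alt-distrib-+ (suc k) x y = trans (-‿cong (alt-distrib-+ k x y)) (sym (-‿+-comm _ _))

  alt-neg : ∀ k x → alt R k (- x) ≈ - alt R k x
  alt-neg zero    x = refl
  alt-neg (suc k) x = -‿cong (alt-neg k x)

  alt-zero : ∀ k → alt R k 0# ≈ 0#
  alt-zero zero    = refl
  alt-zero (suc k) = trans (-‿cong (alt-zero k)) -0#≈0#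

  *-alt : ∀ k x y → x * alt R k y ≈ alt R k (x * y)
  *-alt zero    x y = refl
  *-alt (suc k) x y = trans (sym (-‿distribʳ-* x _)) (-‿cong (*-alt k x y))

  ι-homo-+ : ∀ m n → ι R (m Nat.+ n) ≈ ι R m + ι R n
  ι-homo-+ zero    n = sym (+-identityˡ _)
  ι-homo-+ (suc m) n = trans (+-congˡ (ι-homo-+ m n)) (sym (+-assoc _ _ _))

  ι-homo-* : ∀ m n → ι R (m Nat.* n) ≈ ι R m * ι R n
  ι-homo-* zero    n = sym (zeroˡ _)
  ι-homo-* (suc m) n = begin
    ι R (n Nat.+ m Nat.* n)     ≈⟨ ι-homo-+ n (m Nat.* n) ⟩
    ι R n + ι R (m Nat.* n)     ≈⟨ +-cong (sym (*-identityˡ _)) (ι-homo-* m n) ⟩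
    1# * ι R n + ι R m * ι R n  ≈⟨ distribʳ _ _ _ ⟨
    (1# + ι R m) * ι R n        ∎

  ι-pascal : ∀ n k → ι R (suc n C suc k) ≈ ι R (n C k) + ι R (n C suc k)
  ι-pascal n k = trans (reflexive (≡.cong (ι R) (≡.sym (nCk+nC[k+1]≡[n+1]C[k+1] n k))))
                       (ι-homo-+ (n C k) (n C suc k))

  ι-absorption : ∀ n k x →
    ι R (suc n) * (ι R (n C k) * x) ≈ ι R (suc n C suc k) * (ι R (suc k) * x)
  ι-absorption n k x = begin
    ι R (suc n) * (ι R (n C k) * x)          ≈⟨ *-assoc _ _ x ⟨
    (ι R (suc n) * ι R (n C k)) * x          ≈⟨ *-congʳ (ι-homo-* (suc n) (n C k)) ⟨
    ι R (suc n Nat.* (n C k)) * x            ≈⟨ *-congʳ (reflexive (≡.cong (ι R) absorption)) ⟩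
    ι R ((suc n C suc k) Nat.* suc k) * x    ≈⟨ *-congʳ (ι-homo-* (suc n C suc k) (suc k)) ⟩
    (ι R (suc n C suc k) * ι R (suc k)) * x  ≈⟨ *-assoc _ _ x ⟩
    ι R (suc n C suc k) * (ι R (suc k) * x)  ∎
    where
    absorption : suc n Nat.* (n C k) ≡ (suc n C suc k) Nat.* suc k
    absorption = [1+n]*nCk≡[1+n]C[1+k]*[1+k] n k

  binomial : (ℕ → Carrier) → ℕ → Carrier
  binomial f n = Σ≤ R n (λ k → alt R k (ι R (n C k) * f k))

  shiftedBinomial : (ℕ → Carrier) → ℕ → Carrier
  shiftedBinomial g n = Σ≤ R n (λ k → alt R k (ι R (suc n C suc k) * g k))

  binomial-zero : ∀ f → binomial f 0 ≈ f 0
  binomial-zero f = trans (*-congʳ (+-identityʳ 1#)) (*-identityˡ _)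

  binomial-cong : ∀ n {f g} → (∀ k → f k ≈ g k) → binomial f n ≈ binomial g n
  binomial-cong n f≈g = Σ≤-cong n (λ k → alt-cong k (*-congˡ (f≈g k)))

  binomial-distrib-- : ∀ n f g → binomial (λ k → f k - g k) n ≈ binomial f n - binomial g n
  binomial-distrib-- n f g = trans (Σ≤-cong n term) (Σ≤-distrib-- n _ _)
    where
    term : ∀ k → alt R k (ι R (n C k) * (f k - g k))
               ≈ alt R k (ι R (n C k) * f k) - alt R k (ι R (n C k) * g k)
    term k = trans (alt-cong k (x[y-z]≈xy-xz _ _ _))
                   (trans (alt-distrib-+ k _ _) (+-congˡ (alt-neg k _)))

  binomial-suc : ∀ f n → binomial f (suc n) ≈ binomial f n - binomial (f ∘ suc) n
  binomial-suc f n = begin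
    binomial f (suc n)
      ≈⟨ Σ≤-sucˡ n _ ⟩
    T 0 + Σ≤ R n (λ k → alt R (suc k) (ι R (suc n C suc k) * f (suc k)))
      ≈⟨ +-congˡ (Σ≤-cong n pascal-split) ⟩
    T 0 + Σ≤ R n (λ k → T (suc k) - alt R k (ι R (n C k) * f (suc k)))
      ≈⟨ +-congˡ (Σ≤-distrib-- n _ _) ⟩
    T 0 + (Σ≤ R n (T ∘ suc) - binomial (f ∘ suc) n)
      ≈⟨ +-assoc _ _ _ ⟨
    (T 0 + Σ≤ R n (T ∘ suc)) - binomial (f ∘ suc) n
      ≈⟨ +-congʳ (Σ≤-sucˡ n T) ⟨
    (binomial f n + T (suc n)) - binomial (f ∘ suc) n
      ≈⟨ +-congʳ (trans (+-congˡ top-vanishes) (+-identityʳ _)) ⟩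
    binomial f n - binomial (f ∘ suc) n
      ∎
    where
    T : ℕ → Carrier
    T k = alt R k (ι R (n C k) * f k)
    pascal-split : ∀ k → alt R (suc k) (ι R (suc n C suc k) * f (suc k))
                         ≈ T (suc k) - alt R k (ι R (n C k) * f (suc k))
    pascal-split k = begin
      alt R (suc k) (ι R (suc n C suc k) * f (suc k))
        ≈⟨ alt-cong (suc k) (trans (*-congʳ (ι-pascal n k)) (distribʳ _ _ _)) ⟩
      alt R (suc k) (ι R (n C k) * f (suc k) + ι R (n C suc k) * f (suc k))
        ≈⟨ trans (alt-distrib-+ (suc k) _ _) (+-comm _ _) ⟩
      T (suc k) - alt R k (ι R (n C k) * f (suc k))
        ∎
    top-vanishes : T (suc n) ≈ 0#
    top-vanishes = begin
      alt R (suc n) (ι R (n C suc n) * f (suc n))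
        ≈⟨ alt-cong (suc n) (*-congʳ (reflexive (≡.cong (ι R) (k>n⇒nCk≡0 (n<1+n n))))) ⟩
      alt R (suc n) (0# * f (suc n))
        ≈⟨ trans (alt-cong (suc n) (zeroˡ _)) (alt-zero (suc n)) ⟩
      0#
        ∎

  binomial-sucˡ : ∀ g n → binomial g (suc n) ≈ g 0 - shiftedBinomial (g ∘ suc) n
  binomial-sucˡ g n = trans (Σ≤-sucˡ n _) (+-cong (binomial-zero g) (Σ≤-neg n _))

  binomial-involutive : ∀ f n → binomial (binomial f) n ≈ f n
  binomial-involutive f zero    = trans (binomial-zero (binomial f)) (binomial-zero f)
  binomial-involutive f (suc n) = begin
    binomial (binomial f) (suc n)
      ≈⟨ binomial-suc (binomial f) n ⟩
    binomial (binomial f) n - binomial (binomial f ∘ suc) n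
      ≈⟨ +-congˡ (-‿cong (binomial-cong n (binomial-suc f))) ⟩
    binomial (binomial f) n - binomial (λ k → binomial f k - binomial (f ∘ suc) k) n
      ≈⟨ +-congˡ (-‿cong (binomial-distrib-- n _ _)) ⟩
    binomial (binomial f) n - (binomial (binomial f) n - binomial (binomial (f ∘ suc)) n)
      ≈⟨ x-[x-y]≈y _ _ ⟩
    binomial (binomial (f ∘ suc)) n
      ≈⟨ binomial-involutive (f ∘ suc) n ⟩
    f (suc n)
      ∎
    where
    x-[x-y]≈y : ∀ x y → x - (x - y) ≈ y
    x-[x-y]≈y x y =
      trans (+-congˡ (⁻¹-anti-homo‿- x y)) (trans (+-comm _ _) (//-rightDividesˡ x y))

  BinomialPair₁-sym : ∀ {t τ} → BinomialPair₁ R t τ → BinomialPair₁ R τ t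
  BinomialPair₁-sym {t} τ≈Bt n = sym (trans (binomial-cong n τ≈Bt) (binomial-involutive t n))

  binomial-absorption : (inv : ℕ → Carrier) → (∀ k → ι R (suc k) * inv k ≈ 1#) →
    ∀ g n → ι R (suc n) * binomial (λ k → inv k * g k) n ≈ shiftedBinomial g n
  binomial-absorption inv [1+k]*inv≈1 g n =
    trans (*-distribˡ-Σ≤ n _ _) (Σ≤-cong n λ k → trans (*-alt k _ _) (alt-cong k (term k)))
    where
    term : ∀ k → ι R (suc n) * (ι R (n C k) * (inv k * g k)) ≈ ι R (suc n C suc k) * g k
    term k = begin
      ι R (suc n) * (ι R (n C k) * (inv k * g k))          ≈⟨ ι-absorption n k _ ⟩
      ι R (suc n C suc k) * (ι R (suc k) * (inv k * g k))
        ≈⟨ *-congˡ (*-inverse-cancelˡ ([1+k]*inv≈1 k) (g k)) ⟩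
      ι R (suc n C suc k) * g k                            ∎

  shiftedBinomial-partialSums : ∀ f n → shiftedBinomial (λ k → Σ≤ R k f) n ≈ binomial f n
  shiftedBinomial-partialSums f n = begin
    shiftedBinomial S n                    ≈⟨ -‿involutive _ ⟨
    - - shiftedBinomial S n                ≈⟨ -‿cong (+-identityˡ _) ⟨
    - (0# - shiftedBinomial S n)           ≈⟨ -‿cong (binomial-sucˡ S< n) ⟨
    - binomial S< (suc n)                  ≈⟨ -‿cong (binomial-suc S< n) ⟩
    - (binomial S< n - binomial S n)       ≈⟨ ⁻¹-anti-homo‿- _ _ ⟩
    binomial S n - binomial S< n           ≈⟨ binomial-distrib-- n S S< ⟨
    binomial (λ k → S k - S< k) n          ≈⟨ binomial-cong n S-S<≈f ⟩
    binomial f n                           ∎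
    where
    S : ℕ → Carrier
    S k = Σ≤ R k f
    S< : ℕ → Carrier
    S< zero    = 0#
    S< (suc k) = S k
    S-S<≈f : ∀ k → S k - S< k ≈ f k
    S-S<≈f zero    = trans (+-congˡ -0#≈0#) (+-identityʳ _)
    S-S<≈f (suc k) = xyx⁻¹≈y (S k) (f (suc k))

open BinomialTransform

theorem17 : {c ℓ : Level} (R : CommutativeRing c ℓ) →
    let open CommutativeRing R in
    (inv : ℕ → Carrier) → (∀ k → ι R (suc k) * inv k ≈ 1#) →
    (t τ : ℕ → Carrier) → BinomialPair₁ R t τ →
    BinomialPair₁ R (λ k → inv k * Σ≤ R k τ) (λ k → inv k * t k)
theorem17 R inv [1+k]*inv≈1 t τ τ≈Bt n = sym $ begin
  binomial R a n                                ≈⟨ *-inverse-cancelˡ R inv*[1+n]≈1 _ ⟨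
  inv n * (ι R (suc n) * binomial R a n)        ≈⟨ *-congˡ (binomial-absorption R inv [1+k]*inv≈1 _ n) ⟩
  inv n * shiftedBinomial R (λ k → Σ≤ R k τ) n  ≈⟨ *-congˡ (shiftedBinomial-partialSums R τ n) ⟩
  inv n * binomial R τ n                        ≈⟨ *-congˡ (BinomialPair₁-sym R τ≈Bt n) ⟨
  inv n * t n                                   ∎
  where
  open CommutativeRing R
  open import Relation.Binary.Reasoning.Setoid setoid
  a : ℕ → Carrier
  a k = inv k * Σ≤ R k τ
  inv*[1+n]≈1 : inv n * ι R (suc n) ≈ 1#
  inv*[1+n]≈1 = trans (*-comm _ _) ([1+k]*inv≈1 n)
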